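{- Let $G=(V,E)$ be a graph, $k\ge 1$ an integer, and let $v\in V$ satisfy $|N(v)|>7k$ and $\rho(v)\le \frac{|N(v)|(|N(v)|-1)}{4}$. Then for every feasible solution $X$ with $v\notin X$, the vertex $v$ lies in a connected component of $G-X$ that is a tree.
   Context: Graphs are undirected, without self-loops, possibly with multi-edges. $N(v)$ is the set of neighbors of $v$; $\rho(v)$ is the number of unordered pairs $\{u_1,u_2\}\subseteq N(v)$ with $u_1u_2\in E$ (parallel edges counted once). A set induces a clique if there is exactly one edge between any two distinct vertices; it induces a tree if connected with no cycle (parallel edges form a cycle). A feasible solution for $(G,k)$ is a set $X\subseteq V$ with $|X|\le k$ such that every connected component of $G-X$ is a clique or a tree. -}

module Defs where

open import Data.Nat using (ℕ; zero; suc; _+_; _*_; _∸_; _≤_; _<_; _≤?_; _<?_)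
open import Data.Fin using (Fin; zero; suc; toℕ; inject₁; fromℕ)
open import Data.Fin.Subset using (Subset; _∈_; _∉_)
open import Data.List using (List; length; filter; allFin; concatMap; map)
open import Data.Product using (_×_; _,_; Σ; ∃)
open import Data.Sum using (_⊎_)
open import Relation.Binary.PropositionalEquality using (_≡_; _≢_)
open import Relation.Nullary using (¬_)
open import Relation.Nullary.Decidable using (_×-dec_)
open import Function.Definitions using (Injective)

-- A finite multigraph on vertex set Fin n: mult u v = number of (parallel)
-- edges between u and v; symmetric, no self-loops.
record Graph (n : ℕ) : Set where
  field
    mult    : Fin n → Fin n → ℕ
    sym     : ∀ u v → mult u v ≡ mult v u
    noloop  : ∀ v → mult v v ≡ 0

open Graph public

Adj : ∀ {n} → Graph n → Fin n → Fin n → Set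
Adj G u v = 1 ≤ mult G u v

deg : ∀ {n} → Graph n → Fin n → ℕ
deg {n} G v = length (filter (λ u → 1 ≤? mult G v u) (allFin n))

-- ρ(v): number of unordered pairs {u1,u2} ⊆ N(v) (u1 ≠ u2, counted once via
-- toℕ u1 < toℕ u2) such that u1 u2 is an edge (parallel edges counted once)
rho : ∀ {n} → Graph n → Fin n → ℕ
rho {n} G v =
  length (filter
    (λ p → let u₁ = Data.Product.proj₁ p ; u₂ = Data.Product.proj₂ p in
           (toℕ u₁ <? toℕ u₂) ×-dec ((1 ≤? mult G v u₁) ×-dec ((1 ≤? mult G v u₂) ×-dec (1 ≤? mult G u₁ u₂))))
    (concatMap (λ a → map (λ b → (a , b)) (allFin n)) (allFin n)))

data Reach {n} (G : Graph n) (X : Subset n) : Fin n → Fin n → Set where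
  here : ∀ {u} → u ∉ X → Reach G X u u
  step : ∀ {u w x} → Reach G X u w → Adj G w x → x ∉ X → Reach G X u x

-- The vertex set of the connected component of G - X containing w
-- (empty if w ∈ X).
Comp : ∀ {n} → Graph n → Subset n → Fin n → Fin n → Set
Comp G X w u = Reach G X w u

IsClique : ∀ {n} → Graph n → (Fin n → Set) → Set
IsClique G P = ∀ a b → P a → P b → a ≢ b → mult G a b ≡ 1

-- A cycle inside P: either two parallel edges between two vertices of P,
-- or distinct vertices f 0, …, f (m+2) (m+3 ≥ 3 of them) in P with
-- consecutive ones adjacent and the last adjacent to the first.
HasCycle : ∀ {n} → Graph n → (Fin n → Set) → Set
HasCycle {n} G P =
    (Σ (Fin n) λ a → Σ (Fin n) λ b → P a × P b × 2 ≤ mult G a b)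
  ⊎ (Σ ℕ λ m → Σ (Fin (suc (suc (suc m))) → Fin n) λ f →
        Injective _≡_ _≡_ f
      × (∀ i → P (f i))
      × (∀ (i : Fin (suc (suc m))) → Adj G (f (inject₁ i)) (f (suc i)))
      × Adj G (f (fromℕ (suc (suc m)))) (f zero))

IsTree : ∀ {n} → Graph n → Subset n → (Fin n → Set) → Set
IsTree G X P = (∀ a b → P a → P b → Reach G X a b) × ¬ HasCycle G P

Feasible : ∀ {n} → Graph n → ℕ → Subset n → Set
Feasible {n} G k X =
  Data.Fin.Subset.∣ X ∣ ≤ k
  × (∀ (w : Fin n) → w ∉ X → IsClique G (Comp G X w) ⊎ IsTree G X (Comp G X w))

{-# OPTIONS --safe #-}
-- If the component of v in G − X were a clique, the c ≥ |N(v)| − k neighbours of v outside X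
-- would be pairwise adjacent, so 2ρ(v) ≥ c(c − 1).  As c > 6k, this forces
-- 4ρ(v) ≥ 2c(c − 1) > (c + k)(c + k − 1) ≥ |N(v)|(|N(v)| − 1), contradicting the bound on ρ(v).
module Submission where

open import Level using (Level; _⊔_; 0ℓ)
open import Data.Nat using (ℕ; zero; suc; _+_; _*_; _∸_; _≤_; _<_; z≤n; s≤s; z<s; s<s)
open import Data.Nat.Properties
open import Data.Nat.Tactic.RingSolver using (solve-∀)
open import Data.Fin as Fin using (Fin; toℕ)
open import Data.Fin.Properties as Fin using ()
open import Data.Fin.Subset using (Subset; _∈_; _∉_; inside; outside; ∣_∣)
open import Data.Fin.Subset.Properties using (_∈?_; drop-there)
open import Data.Vec as Vec using (_∷_; there)
open import Data.List using (List; []; _∷_; length; filter; map; concatMap; _++_; tabulate; allFin)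
open import Data.List.Properties using (filter-accept; filter-reject; filter-++; filter-none; length-++; map-tabulate)
open import Data.List.Relation.Unary.All as All using (All; []; _∷_)
open import Data.List.Relation.Unary.All.Properties as All using ()
open import Data.List.Relation.Unary.AllPairs using (AllPairs; []; _∷_)
open import Data.Product using (_×_; _,_; proj₁; proj₂)
open import Data.Sum using (inj₁; inj₂)
open import Data.Empty using (⊥-elim)
open import Function using (_∘_; id)
open import Relation.Nullary using (¬_; Dec; yes; no; ¬?; contradiction)
open import Relation.Nullary.Decidable using (_×-dec_)
open import Relation.Unary using (Pred; Decidable; _⊆_; _∪_; ∁)
open import Relation.Unary.Properties using (_∪?_)
open import Relation.Binary using (Rel; Asymmetric) renaming (Decidable to Decidable₂)
open import Relation.Binary.PropositionalEquality using (_≡_; refl; sym; trans; cong; module ≡-Reasoning)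

open import Defs hiding (sym)

private
  variable
    a b p q ℓ : Level
    A B : Set a

count : {P : Pred A p} → Decidable P → List A → ℕ
count P? xs = length (filter P? xs)

module _ {P : Pred A p} (P? : Decidable P) where

  count-accept : ∀ {x xs} → P x → count P? (x ∷ xs) ≡ suc (count P? xs)
  count-accept = cong length ∘ filter-accept P?

  count-reject : ∀ {x xs} → ¬ P x → count P? (x ∷ xs) ≡ count P? xs
  count-reject = cong length ∘ filter-reject P?

  count-none : ∀ {xs} → All (∁ P) xs → count P? xs ≡ 0
  count-none = cong length ∘ filter-none P?

  count-++ : ∀ xs ys → count P? (xs ++ ys) ≡ count P? xs + count P? ys
  count-++ xs ys = trans (cong length (filter-++ P? xs ys)) (length-++ (filter P? xs))

  count-map : (f : B → A) (xs : List B) → count P? (map f xs) ≡ count (P? ∘ f) xs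
  count-map f []       = refl
  count-map f (x ∷ xs) with P? (f x)
  ... | yes _ = cong suc (count-map f xs)
  ... | no  _ = count-map f xs

  count-tabulate : ∀ {n} (f : Fin n → A) → count P? (tabulate f) ≡ count (P? ∘ f) (allFin n)
  count-tabulate f = trans (cong (count P?) (sym (map-tabulate id f))) (count-map f (allFin _))

module _ {P : Pred A p} {Q : Pred A q} (P? : Decidable P) (Q? : Decidable Q) where

  count-mono : P ⊆ Q → ∀ xs → count P? xs ≤ count Q? xs
  count-mono P⊆Q []       = z≤n
  count-mono P⊆Q (x ∷ xs) with P? x | Q? x
  ... | yes _  | yes _   = s≤s (count-mono P⊆Q xs)
  ... | yes px | no ¬qx  = contradiction (P⊆Q px) ¬qx
  ... | no _   | yes _   = m≤n⇒m≤1+n (count-mono P⊆Q xs)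
  ... | no _   | no _    = count-mono P⊆Q xs

  count-cong-All : ∀ {xs} → All (λ x → (P x → Q x) × (Q x → P x)) xs → count P? xs ≡ count Q? xs
  count-cong-All {[]}     []                = refl
  count-cong-All {x ∷ xs} ((P⇒Q , Q⇒P) ∷ h) with P? x
  ... | yes px = trans (cong suc (count-cong-All h)) (sym (count-accept Q? (P⇒Q px)))
  ... | no ¬px = trans (count-cong-All h) (sym (count-reject Q? (¬px ∘ Q⇒P)))

  count-∪ : ∀ xs → count (P? ∪? Q?) xs ≤ count P? xs + count Q? xs
  count-∪ []       = z≤n
  count-∪ (x ∷ xs) with P? x | Q? x
  ... | yes _ | yes _ = s≤s (≤-trans (count-∪ xs) (+-monoʳ-≤ (count P? xs) (n≤1+n _)))
  ... | yes _ | no  _ = s≤s (count-∪ xs)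
  ... | no  _ | yes _ = ≤-trans (s≤s (count-∪ xs)) (≤-reflexive (sym (+-suc _ _)))
  ... | no  _ | no  _ = count-∪ xs

count-∈-tabulate-suc : ∀ {n} s (p : Subset n) →
                       count (_∈? (s ∷ p)) (tabulate Fin.suc) ≡ count (_∈? p) (allFin n)
count-∈-tabulate-suc {n} s p =
  trans (count-tabulate (_∈? (s ∷ p)) Fin.suc)
        (count-cong-All _ _ (All.universal (λ _ → drop-there , there) (allFin n)))

count-∈≡∣p∣ : ∀ {n} (p : Subset n) → count (_∈? p) (allFin n) ≡ ∣ p ∣
count-∈≡∣p∣ Vec.[]       = refl
count-∈≡∣p∣ (inside  ∷ p) = cong suc (trans (count-∈-tabulate-suc inside p) (count-∈≡∣p∣ p))
count-∈≡∣p∣ (outside ∷ p) = trans (count-∈-tabulate-suc outside p) (count-∈≡∣p∣ p)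

pairs : List A → List B → List (A × B)
pairs xs ys = concatMap (λ x → map (x ,_) ys) xs

tabulate⁺-< : ∀ {n} {R : Rel A ℓ} {f : Fin n → A} →
              (∀ {i j} → i Fin.< j → R (f i) (f j)) → AllPairs R (tabulate f)
tabulate⁺-< {n = zero}  f-mono = []
tabulate⁺-< {n = suc n} f-mono = All.tabulate⁺ (λ _ → f-mono z<s) ∷ tabulate⁺-< (f-mono ∘ s<s)

2*n+n*[n∸1]≡[1+n]*n : ∀ n → 2 * n + n * (n ∸ 1) ≡ suc n * n
2*n+n*[n∸1]≡[1+n]*n zero    = refl
2*n+n*[n∸1]≡[1+n]*n (suc n) = identity n
  where
  identity : ∀ n → 2 * suc n + suc n * n ≡ suc (suc n) * suc n
  identity = solve-∀

module IncreasingPairs {_≺_ : Rel A ℓ} (_≺?_ : Decidable₂ _≺_) (≺-asym : Asymmetric _≺_)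
                       {P : Pred A p} (P? : Decidable P) where

  Increasing : Pred (A × A) (ℓ ⊔ p)
  Increasing (x , y) = x ≺ y × P x × P y

  increasing? : Decidable Increasing
  increasing? (x , y) = (x ≺? y) ×-dec (P? x ×-dec P? y)

  count-row-accept : ∀ {x ys} → P x → All (x ≺_) ys → count increasing? (map (x ,_) ys) ≡ count P? ys
  count-row-accept {x} {ys} px x≺ys = trans (count-map increasing? (x ,_) ys)
    (count-cong-All _ P? (All.map (λ x≺y → proj₂ ∘ proj₂ , λ py → x≺y , px , py) x≺ys))

  count-row-reject : ∀ {x} ys → ¬ P x → count increasing? (map (x ,_) ys) ≡ 0
  count-row-reject {x} ys ¬px = trans (count-map increasing? (x ,_) ys)
    (count-none _ (All.universal (λ _ → ¬px ∘ proj₁ ∘ proj₂) ys))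

  count-column-drop : ∀ {x} xs ys → All (λ y → ¬ y ≺ x) xs →
                      count increasing? (pairs xs (x ∷ ys)) ≡ count increasing? (pairs xs ys)
  count-column-drop []       ys []            = refl
  count-column-drop {x} (y ∷ xs) ys (y⊀x ∷ xs⊀x) = begin
    count increasing? ((y , x) ∷ row ++ pairs xs (x ∷ ys))     ≡⟨ count-reject increasing? (y⊀x ∘ proj₁) ⟩
    count increasing? (row ++ pairs xs (x ∷ ys))               ≡⟨ count-++ increasing? row _ ⟩
    count increasing? row + count increasing? (pairs xs (x ∷ ys)) ≡⟨ cong (count increasing? row +_) (count-column-drop xs ys xs⊀x) ⟩
    count increasing? row + count increasing? (pairs xs ys)      ≡⟨ sym (count-++ increasing? row _) ⟩
    count increasing? (row ++ pairs xs ys)                     ∎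
    where
    open ≡-Reasoning
    row : List (A × A)
    row = map (y ,_) ys

  count-pairs-∷ : ∀ {x xs} → All (x ≺_) xs →
                  count increasing? (pairs (x ∷ xs) (x ∷ xs))
                    ≡ count increasing? (map (x ,_) xs) + count increasing? (pairs xs xs)
  count-pairs-∷ {x} {xs} x≺xs = begin
    count increasing? ((x , x) ∷ map (x ,_) xs ++ pairs xs (x ∷ xs))
      ≡⟨ count-reject increasing? (λ (x≺x , _) → ≺-asym x≺x x≺x) ⟩
    count increasing? (map (x ,_) xs ++ pairs xs (x ∷ xs))
      ≡⟨ count-++ increasing? (map (x ,_) xs) _ ⟩
    count increasing? (map (x ,_) xs) + count increasing? (pairs xs (x ∷ xs))
      ≡⟨ cong (count increasing? (map (x ,_) xs) +_) (count-column-drop xs xs (All.map ≺-asym x≺xs)) ⟩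
    count increasing? (map (x ,_) xs) + count increasing? (pairs xs xs) ∎
    where open ≡-Reasoning

  2*count-increasing≡c*[c∸1] : ∀ {xs} → AllPairs _≺_ xs →
                               2 * count increasing? (pairs xs xs) ≡ count P? xs * (count P? xs ∸ 1)
  2*count-increasing≡c*[c∸1] []                            = refl
  2*count-increasing≡c*[c∸1] {x ∷ xs} (x≺xs ∷ sorted) = by-cases (P? x)
    where
    open ≡-Reasoning
    c r : ℕ
    c = count P? xs
    r = count increasing? (pairs xs xs)
    by-cases : Dec (P x) → 2 * count increasing? (pairs (x ∷ xs) (x ∷ xs))
                             ≡ count P? (x ∷ xs) * (count P? (x ∷ xs) ∸ 1)
    by-cases (yes px) = begin
      2 * count increasing? (pairs (x ∷ xs) (x ∷ xs)) ≡⟨ cong (2 *_) (count-pairs-∷ x≺xs) ⟩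
      2 * (count increasing? (map (x ,_) xs) + r)     ≡⟨ cong (λ m → 2 * (m + r)) (count-row-accept px x≺xs) ⟩
      2 * (c + r)                                     ≡⟨ *-distribˡ-+ 2 c r ⟩
      2 * c + 2 * r                                   ≡⟨ cong (2 * c +_) (2*count-increasing≡c*[c∸1] sorted) ⟩
      2 * c + c * (c ∸ 1)                             ≡⟨ 2*n+n*[n∸1]≡[1+n]*n c ⟩
      suc c * c                                       ≡⟨ cong (λ m → m * (m ∸ 1)) (count-accept P? px) ⟨
      count P? (x ∷ xs) * (count P? (x ∷ xs) ∸ 1)     ∎
    by-cases (no ¬px) = begin
      2 * count increasing? (pairs (x ∷ xs) (x ∷ xs)) ≡⟨ cong (2 *_) (count-pairs-∷ x≺xs) ⟩
      2 * (count increasing? (map (x ,_) xs) + r)     ≡⟨ cong (λ m → 2 * (m + r)) (count-row-reject xs ¬px) ⟩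
      2 * r                                           ≡⟨ 2*count-increasing≡c*[c∸1] sorted ⟩
      c * (c ∸ 1)                                     ≡⟨ cong (λ m → m * (m ∸ 1)) (count-reject P? ¬px) ⟨
      count P? (x ∷ xs) * (count P? (x ∷ xs) ∸ 1)     ∎

OutNeighbour : ∀ {n} → Graph n → Subset n → Fin n → Pred (Fin n) 0ℓ
OutNeighbour G X v u = Adj G v u × u ∉ X

outNeighbour? : ∀ {n} (G : Graph n) (X : Subset n) (v : Fin n) → Decidable (OutNeighbour G X v)
outNeighbour? G X v u = (1 ≤? mult G v u) ×-dec ¬? (u ∈? X)

degOutside : ∀ {n} → Graph n → Subset n → Fin n → ℕ
degOutside {n} G X v = count (outNeighbour? G X v) (allFin n)

deg≤degOutside+∣X∣ : ∀ {n} (G : Graph n) (X : Subset n) (v : Fin n) → deg G v ≤ degOutside G X v + ∣ X ∣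
deg≤degOutside+∣X∣ {n} G X v = begin
  deg G v                                                 ≤⟨ count-mono _ _ split (allFin n) ⟩
  count (outNeighbour? G X v ∪? (_∈? X)) (allFin n)       ≤⟨ count-∪ _ _ (allFin n) ⟩
  degOutside G X v + count (_∈? X) (allFin n)             ≡⟨ cong (degOutside G X v +_) (count-∈≡∣p∣ X) ⟩
  degOutside G X v + ∣ X ∣                                ∎
  where
  open ≤-Reasoning
  split : Adj G v ⊆ OutNeighbour G X v ∪ (_∈ X)
  split {u} adj with u ∈? X
  ... | yes u∈X = inj₂ u∈X
  ... | no  u∉X = inj₁ (adj , u∉X)

clique⇒degOutside*[degOutside∸1]≤2*rho :
  ∀ {n} (G : Graph n) (X : Subset n) (v : Fin n) → v ∉ X → IsClique G (Comp G X v) →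
  degOutside G X v * (degOutside G X v ∸ 1) ≤ 2 * rho G v
clique⇒degOutside*[degOutside∸1]≤2*rho {n} G X v v∉X clique = begin
  degOutside G X v * (degOutside G X v ∸ 1)
    ≡⟨ 2*count-increasing≡c*[c∸1] (tabulate⁺-< id) ⟨
  2 * count increasing? (pairs (allFin n) (allFin n))
    ≤⟨ *-monoʳ-≤ 2 (count-mono increasing? _ adjacent (pairs (allFin n) (allFin n))) ⟩
  2 * rho G v
    ∎
  where
  open ≤-Reasoning
  open IncreasingPairs Fin._<?_ Fin.<-asym (outNeighbour? G X v)
  reach : ∀ {u} → OutNeighbour G X v u → Reach G X v u
  reach (v~u , u∉X) = step (here v∉X) v~u u∉X
  adjacent : Increasing ⊆ λ (u , w) → toℕ u < toℕ w × Adj G v u × Adj G v w × Adj G u w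
  adjacent {u , w} (u<w , u∈N , w∈N) =
    u<w , proj₁ u∈N , proj₁ w∈N , ≤-reflexive (sym (clique u w (reach u∈N) (reach w∈N) (Fin.<⇒≢ u<w)))

n*[n∸1]-mono-≤ : ∀ {m n} → m ≤ n → m * (m ∸ 1) ≤ n * (n ∸ 1)
n*[n∸1]-mono-≤ m≤n = *-mono-≤ m≤n (∸-monoˡ-≤ 1 m≤n)

[c+k]*[c+k∸1]<2*c*[c∸1] : ∀ {k c} → 1 ≤ k → 6 * k < c → (c + k) * (c + k ∸ 1) < 2 * (c * (c ∸ 1))
[c+k]*[c+k∸1]<2*c*[c∸1] {k@(suc _)} _ 6k<c with m≤n⇒∃[o]m+o≡n 6k<c
... | s , refl = ≤-trans (m<m+n _ z<s) (≤-reflexive (excess k s))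
  where
  excess : ∀ k s → (suc (6 * k + s) + k) * (6 * k + s + k)
                     + (k + (4 * k + 23 * k * k + 10 * k * s + s * s + s))
                   ≡ 2 * (suc (6 * k + s) * (6 * k + s))
  excess = solve-∀

lemma5 : ∀ {n} (G : Graph n) (k : ℕ) (v : Fin n)
         → 1 ≤ k
         → 7 * k < deg G v
         → 4 * rho G v ≤ deg G v * (deg G v ∸ 1)
         → (X : Subset n) → Feasible G k X → v ∉ X
         → IsTree G X (Comp G X v)
lemma5 G k v 1≤k 7k<d 4ρ≤d[d∸1] X (∣X∣≤k , feasible) v∉X with feasible v v∉X
... | inj₂ tree   = tree
... | inj₁ clique = ⊥-elim (<-irrefl refl (begin-strict
  2 * (c * (c ∸ 1))         ≤⟨ *-monoʳ-≤ 2 (clique⇒degOutside*[degOutside∸1]≤2*rho G X v v∉X clique) ⟩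
  2 * (2 * rho G v)         ≡⟨ *-assoc 2 2 (rho G v) ⟨
  4 * rho G v               ≤⟨ 4ρ≤d[d∸1] ⟩
  deg G v * (deg G v ∸ 1)   ≤⟨ n*[n∸1]-mono-≤ d≤c+k ⟩
  (c + k) * (c + k ∸ 1)     <⟨ [c+k]*[c+k∸1]<2*c*[c∸1] 1≤k 6k<c ⟩
  2 * (c * (c ∸ 1))         ∎))
  where
  open ≤-Reasoning
  c : ℕ
  c = degOutside G X v
  d≤c+k : deg G v ≤ c + k
  d≤c+k = ≤-trans (deg≤degOutside+∣X∣ G X v) (+-monoʳ-≤ c ∣X∣≤k)
  6k<c : 6 * k < c
  6k<c = +-cancelˡ-< k (6 * k) c (<-≤-trans 7k<d (≤-trans d≤c+k (≤-reflexive (+-comm c k))))
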